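{- The poset $\Sigma_m^kC_m^n$ is isomorphic to the sublattice of $C_m^{n+k}$ consisting of those elements $(x_1,\dots,x_{n+k})$ that satisfy: for each $i\in\{1,\dots,n\}$, $x_i\leqslant x_{n+1}\leqslant x_{n+2}\leqslant\dots\leqslant x_{n+k}$.
   Context: $C_m$ denotes the chain $\{0,1,\dots,m\}$ with $m+1$ elements, and $C^n_m$ its $n$-th cartesian power with the componentwise order. Consider the sequence $C^n_0\to C^n_1\to C^n_2\to\cdots$, where each map $C^n_i\to C^n_{i+1}$ is the coordinatewise inclusion induced by the inclusion $C_i\subseteq C_{i+1}$ (a down-closed sub-join-semilattice). For a sequence of posets and monotone maps $f_i\colon M_i\to M_{i+1}$, the lax sum (lax colimit in the 2-category of posets) $\Sigma_nM_n$ is the set of pairs $(x,j)$ with $j\in\{0,\dots,n\}$ and $x\in M_j$, ordered by $(x,j)\leqslant(y,k)$ iff $j\leqslant k$ and $(f_{k-1}\circ\dots\circ f_j)(x)\leqslant y$ (with the composite being the identity when $j=k$). The lax sums form a new sequence $\Sigma_0M_0\to\Sigma_1M_1\to\cdots$ via the maps $(x,j)\mapsto(x,j)$; iterating the construction $k$ times gives $\Sigma^k_nM_n$, with $\Sigma^0_nM_n=M_n$ and $\Sigma^1_nM_n=\Sigma_nM_n$. Here $\Sigma^k_mC^n_m$ is the $k$-th iterated lax sum of the sequence $C^n_0\to C^n_1\to\cdots$ taken at index $m$. -}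

module Defs where

open import Level using (0ℓ)
open import Data.Nat using (ℕ; zero; suc; _+_; _≤_; _≤′_; ≤′-refl; ≤′-step)
open import Data.Fin using (Fin; toℕ; inject₁; _↑ˡ_; _↑ʳ_) renaming (zero to zeroF; suc to sucF)
open import Data.Fin.Properties using (toℕ-inject₁)
open import Data.Vec.Properties using (lookup-map)
open import Data.Unit using (⊤)
open import Data.List using (List; allFin)
open import Data.List.Relation.Unary.All using (All)
open import Data.Vec using (Vec; lookup; map)
open import Data.Product using (Σ; _×_; _,_)
open import Function using (_∘_; id)
open import Relation.Binary.PropositionalEquality using (_≡_)

record Seq : Set₁ where
  field
    M    : ℕ → Set
    _≼_  : ∀ {i} → M i → M i → Set
    f    : ∀ i → M i → M (suc i)
    mono : ∀ i {x y : M i} → x ≼ y → f i x ≼ f i y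

transport : (S : Seq) → ∀ {j k} → j ≤′ k → Seq.M S j → Seq.M S k
transport S ≤′-refl x = x
transport S (≤′-step p) x = Seq.f S _ (transport S p x)

record LaxElem (S : Seq) (n : ℕ) : Set where
  constructor lax
  field
    idx   : ℕ
    bound : idx ≤′ n
    elt   : Seq.M S idx

LaxLe : (S : Seq) (n : ℕ) → LaxElem S n → LaxElem S n → Set
LaxLe S n (lax j _ x) (lax k _ y) =
  Σ (j ≤′ k) λ p → Seq._≼_ S (transport S p x) y

laxMono : (S : Seq) (n : ℕ) {a b : LaxElem S n} →
          LaxLe S n a b →
          LaxLe S (suc n) (lax (LaxElem.idx a) (≤′-step (LaxElem.bound a)) (LaxElem.elt a))
                          (lax (LaxElem.idx b) (≤′-step (LaxElem.bound b)) (LaxElem.elt b))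
laxMono S n le = le

LaxSum : Seq → Seq
LaxSum S = record
  { M    = LaxElem S
  ; _≼_  = λ {n} → LaxLe S n
  ; f    = λ n a → lax (LaxElem.idx a) (≤′-step (LaxElem.bound a)) (LaxElem.elt a)
  ; mono = λ n le → le
  }

IterLax : ℕ → Seq → Seq
IterLax zero    S = S
IterLax (suc k) S = LaxSum (IterLax k S)

-- The chain C_m = {0,…,m} is Fin (suc m); C_m^n is Vec (Fin (suc m)) n
-- with the componentwise order.
_≤C_ : ∀ {n m} → Vec (Fin (suc m)) n → Vec (Fin (suc m)) n → Set
_≤C_ {n} x y = ∀ (i : Fin n) → toℕ (lookup x i) ≤ toℕ (lookup y i)

ChainSeq : ℕ → Seq
ChainSeq n = record
  { M    = λ m → Vec (Fin (suc m)) n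
  ; _≼_  = _≤C_
  ; f    = λ m → map inject₁
  ; mono = λ m {x} {y} le i → monoHelper x y le i
  }
  where
  monoHelper : ∀ {m} (x y : Vec (Fin (suc m)) n) → x ≤C y →
               map inject₁ x ≤C map inject₁ y
  monoHelper x y le i
    rewrite lookup-map i inject₁ x | lookup-map i inject₁ y
          | toℕ-inject₁ (lookup x i) | toℕ-inject₁ (lookup y i) = le i

-- Coordinates 1..n are the indices (i ↑ˡ k), coordinates n+1..n+k are (n ↑ʳ j).
-- The universally quantified conditions are expressed with 'All' over
-- 'allFin' (inductive data), so that propositional equality of elements of the
-- subtype is well-behaved without function extensionality.
SubLatCond : ∀ n k m → Vec (Fin (suc m)) (n + k) → Set
SubLatCond n zero    m x = ⊤
SubLatCond n (suc k) m x =
  All (λ i → toℕ (lookup x (i ↑ˡ suc k)) ≤ toℕ (lookup x (n ↑ʳ zeroF))) (allFin n)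
  × All (λ j → toℕ (lookup x (n ↑ʳ inject₁ j)) ≤ toℕ (lookup x (n ↑ʳ sucF j))) (allFin k)

SubLat : ℕ → ℕ → ℕ → Set
SubLat n k m = Σ (Vec (Fin (suc m)) (n + k)) (SubLatCond n k m)

_≤S_ : ∀ {n k m} → SubLat n k m → SubLat n k m → Set
(x , _) ≤S (y , _) = x ≤C y

record OrderIso (A : Set) (_≤A_ : A → A → Set)
                (B : Set) (_≤B_ : B → B → Set) : Set where
  field
    to       : A → B
    from     : B → A
    from∘to  : ∀ a → from (to a) ≡ a
    to∘from  : ∀ b → to (from b) ≡ b
    to-mono  : ∀ {a a′} → a ≤A a′ → to a ≤B to a′
    to-reflects : ∀ {a a′} → to a ≤B to a′ → a ≤A a′

-- An element of Σ^k_m C^n_m is a nested pair (((x , j₁) , j₂) , … , j_k) with x ∈ C^n_{j₁}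
-- and j₁ ≤ j₂ ≤ ⋯ ≤ j_k ≤ m.  Since all connecting maps are inclusions, x may be read in
-- C^n_m, and (x , j₁ , … , j_k) is a point of C^{n+k}_m with x_i ≤ j₁ ≤ ⋯ ≤ j_k; conversely
-- every such point is obtained by peeling off j_k, then j_{k-1}, and so on.  Two nested pairs
-- compare in the lax order iff their indices and their base points compare, i.e. iff these
-- coordinate vectors compare pointwise.  Finally, a monotone and order-reflecting map with a
-- right inverse out of an antisymmetric order is an isomorphism, and iterated lax sums of
-- antisymmetric sequences stay antisymmetric.
module Submission where

open import Defs
open import Data.Empty using (⊥-elim)
open import Data.Fin using (Fin; zero; suc; toℕ; fromℕ; fromℕ<; inject₁; _↑ˡ_; _↑ʳ_; splitAt)
open import Data.Fin.Properties using (toℕ-injective; toℕ-inject₁; toℕ-fromℕ<; toℕ≤pred[n]; join-splitAt)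
open import Data.List.Membership.Propositional.Properties using (∈-allFin)
import Data.List.Relation.Unary.All as List
open import Data.Nat using (ℕ; zero; suc; _+_; _≤_; _≤′_; ≤′-reflexive; ≤′-refl; ≤′-step; s≤s)
open import Data.Nat.Properties using (≤-refl; ≤-trans; ≤-antisym; ≤-irrelevant; ≡-irrelevant; <⇒≱; ≤′⇒≤; ≤⇒≤′)
open import Data.Product using (_×_; _,_; proj₁)
open import Data.Sum.Properties using ([,]-∘)
open import Data.Unit using (tt)
open import Data.Vec using (Vec; lookup; map; tabulate)
open import Data.Vec.Properties using (lookup-map; lookup∘tabulate)
open import Data.Vec.Relation.Binary.Pointwise.Extensional using (ext; Pointwise-≡⇒≡)
open import Data.Vec.Functional using (Vector; head; tail; init; last; _++_)
open import Data.Vec.Functional.Properties using (lookup-++ˡ; lookup-++ʳ; ++-cong)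
open import Data.Vec.Functional.Relation.Binary.Pointwise using (Pointwise)
import Data.Vec.Functional.Relation.Binary.Pointwise.Properties as Pointwise
open import Data.Vec.Functional.Relation.Unary.All using (All)
import Data.Vec.Functional.Relation.Unary.All.Properties as All
open import Function using (_∘_)
open import Level using (Level)
open import Relation.Binary.Core using (REL)
open import Relation.Binary.Definitions using (Antisymmetric; Reflexive; Irrelevant)
open import Relation.Binary.PropositionalEquality

private
  variable
    ℓ ℓ′ : Level
    A B : Set ℓ
    k : ℕ

≤′-irrelevant : Irrelevant _≤′_
≤′-irrelevant (≤′-reflexive e) (≤′-reflexive e′) = cong ≤′-reflexive (≡-irrelevant e e′)
≤′-irrelevant (≤′-reflexive refl) (≤′-step q) = ⊥-elim (<⇒≱ (s≤s (≤′⇒≤ q)) ≤-refl)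
≤′-irrelevant (≤′-step p) (≤′-reflexive refl) = ⊥-elim (<⇒≱ (s≤s (≤′⇒≤ p)) ≤-refl)
≤′-irrelevant (≤′-step p) (≤′-step q) = cong ≤′-step (≤′-irrelevant p q)

infixl 5 _∷ʳ_
_∷ʳ_ : Vector A k → A → Vector A (suc k)
_∷ʳ_ {k = zero}  xs x _       = x
_∷ʳ_ {k = suc k} xs x zero    = head xs
_∷ʳ_ {k = suc k} xs x (suc i) = (tail xs ∷ʳ x) i

init-∷ʳ : (xs : Vector A k) (x : A) → init (xs ∷ʳ x) ≗ xs
init-∷ʳ xs x zero    = refl
init-∷ʳ xs x (suc i) = init-∷ʳ (tail xs) x i

last-∷ʳ : (xs : Vector A k) (x : A) → last (xs ∷ʳ x) ≡ x
last-∷ʳ {k = zero}  xs x = refl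
last-∷ʳ {k = suc k} xs x = last-∷ʳ (tail xs) x

init-∷ʳ-last : (xs : Vector A (suc k)) → init xs ∷ʳ last xs ≗ xs
init-∷ʳ-last {k = zero}  xs zero    = refl
init-∷ʳ-last {k = suc k} xs zero    = refl
init-∷ʳ-last {k = suc k} xs (suc i) = init-∷ʳ-last (tail xs) i

∷ʳ-cong : {xs ys : Vector A k} → xs ≗ ys → (x : A) → xs ∷ʳ x ≗ ys ∷ʳ x
∷ʳ-cong {k = zero}  eq x _       = refl
∷ʳ-cong {k = suc k} eq x zero    = eq zero
∷ʳ-cong {k = suc k} eq x (suc i) = ∷ʳ-cong (eq ∘ suc) x i

module _ (R : REL A B ℓ′) where

  Pointwise-∷ʳ⁺ : {xs : Vector A k} {ys : Vector B k} {x : A} {y : B} →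
        Pointwise R xs ys → R x y → Pointwise R (xs ∷ʳ x) (ys ∷ʳ y)
  Pointwise-∷ʳ⁺ {k = zero}  rs r _       = r
  Pointwise-∷ʳ⁺ {k = suc k} rs r zero    = rs zero
  Pointwise-∷ʳ⁺ {k = suc k} rs r (suc i) = Pointwise-∷ʳ⁺ (rs ∘ suc) r i

  Pointwise-∷ʳ⁻ : (xs : Vector A k) (ys : Vector B k) {x : A} {y : B} →
        Pointwise R (xs ∷ʳ x) (ys ∷ʳ y) → Pointwise R xs ys × R x y
  Pointwise-∷ʳ⁻ xs ys {x} {y} rs =
    (λ i → subst₂ R (init-∷ʳ xs x i) (init-∷ʳ ys y i) (rs (inject₁ i))) ,
    subst₂ R (last-∷ʳ xs x) (last-∷ʳ ys y) (rs (fromℕ _))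

All-∷ʳ⁺ : {P : A → Set ℓ′} {xs : Vector A k} {x : A} → All P xs → P x → All P (xs ∷ʳ x)
All-∷ʳ⁺ {k = zero}  ps p _       = p
All-∷ʳ⁺ {k = suc k} ps p zero    = ps zero
All-∷ʳ⁺ {k = suc k} {P = P} ps p (suc i) = All-∷ʳ⁺ {P = P} (ps ∘ suc) p i

++-split : ∀ {m} (xs : Vector A (m + k)) → (xs ∘ (_↑ˡ k)) ++ (xs ∘ (m ↑ʳ_)) ≗ xs
++-split {m = m} xs i = trans (sym ([,]-∘ xs (splitAt m i))) (cong xs (join-splitAt m _ i))

Ascending : Vector ℕ (suc k) → Set
Ascending xs = Pointwise _≤_ (init xs) (tail xs)

∷ʳ-ascending : {xs : Vector ℕ (suc k)} {x : ℕ} → Ascending xs → last xs ≤ x → Ascending (xs ∷ʳ x)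
∷ʳ-ascending {k = zero}  asc top zero    = top
∷ʳ-ascending {k = suc k} asc top zero    = asc zero
∷ʳ-ascending {k = suc k} asc top (suc i) = ∷ʳ-ascending (asc ∘ suc) top i

module _ (S : Seq) where
  open Seq S

  transport-invariant : {X : Set} (g : ∀ {i} → M i → X) → (∀ {i} (x : M i) → g (f i x) ≡ g x) →
                        ∀ {j l} (p : j ≤′ l) (x : M j) → g (transport S p x) ≡ g x
  transport-invariant g g-f ≤′-refl     x = refl
  transport-invariant g g-f (≤′-step p) x = trans (g-f _) (transport-invariant g g-f p x)

AntisymmetricSeq : Seq → Set
AntisymmetricSeq S = ∀ {i} → Antisymmetric _≡_ (Seq._≼_ S {i})

laxSum-antisym : (S : Seq) → AntisymmetricSeq S → AntisymmetricSeq (LaxSum S)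
laxSum-antisym S antisym {_} {lax j p x} {lax .j q y} (≤′-refl , x≼y) (l≤j , y≼x) =
  cong₂ (lax j) (≤′-irrelevant p q)
    (antisym x≼y (subst (λ r → Seq._≼_ S (transport S r y) x) (≤′-irrelevant l≤j ≤′-refl) y≼x))
laxSum-antisym S antisym (≤′-step j<l , _) (l≤j , _) = ⊥-elim (<⇒≱ (s≤s (≤′⇒≤ j<l)) (≤′⇒≤ l≤j))

iterLax-antisym : (S : Seq) → AntisymmetricSeq S → ∀ k → AntisymmetricSeq (IterLax k S)
iterLax-antisym S antisym zero    = antisym
iterLax-antisym S antisym (suc k) = laxSum-antisym (IterLax k S) (iterLax-antisym S antisym k)

orderIso-fromRightInverse :
  {A B : Set} {_≤A_ : A → A → Set} {_≤B_ : B → B → Set} →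
  (to : A → B) (from : B → A) → (∀ b → to (from b) ≡ b) →
  (∀ {a a′} → a ≤A a′ → to a ≤B to a′) → (∀ {a a′} → to a ≤B to a′ → a ≤A a′) →
  Antisymmetric _≡_ _≤A_ → Reflexive _≤B_ → OrderIso A _≤A_ B _≤B_
orderIso-fromRightInverse {_≤B_ = _≤B_} to from to∘from mono reflects antisym refl-≤B = record
  { to          = to
  ; from        = from
  ; from∘to     = λ a → antisym (reflects (≤B-reflexive (to∘from (to a))))
                                (reflects (≤B-reflexive (sym (to∘from (to a)))))
  ; to∘from     = to∘from
  ; to-mono     = mono
  ; to-reflects = reflects
  }
  where
  ≤B-reflexive : ∀ {b b′} → b ≡ b′ → b ≤B b′
  ≤B-reflexive refl = refl-≤B

asℕ : ∀ {m l} → Vec (Fin (suc m)) l → Vector ℕ l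
asℕ v = toℕ ∘ lookup v

asℕ-injective : ∀ {m l} {v w : Vec (Fin (suc m)) l} → asℕ v ≗ asℕ w → v ≡ w
asℕ-injective eq = Pointwise-≡⇒≡ (ext (toℕ-injective ∘ eq))

asℕ-bounded : ∀ {m l} (v : Vec (Fin (suc m)) l) → All (_≤ m) (asℕ v)
asℕ-bounded v = toℕ≤pred[n] ∘ lookup v

asℕ-map-inject₁ : ∀ {m l} (v : Vec (Fin (suc m)) l) → asℕ (map inject₁ v) ≗ asℕ v
asℕ-map-inject₁ v i = trans (cong toℕ (lookup-map i inject₁ v)) (toℕ-inject₁ (lookup v i))

fromBounded : ∀ {m l} (xs : Vector ℕ l) → All (_≤ m) xs → Vec (Fin (suc m)) l
fromBounded xs bounded = tabulate (λ i → fromℕ< (s≤s (bounded i)))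

asℕ-fromBounded : ∀ {m l} (xs : Vector ℕ l) (bounded : All (_≤ m) xs) →
                  asℕ (fromBounded xs bounded) ≗ xs
asℕ-fromBounded xs bounded i =
  trans (cong toℕ (lookup∘tabulate _ i)) (toℕ-fromℕ< (s≤s (bounded i)))

chainSeq-antisym : ∀ n → AntisymmetricSeq (ChainSeq n)
chainSeq-antisym n v≤w w≤v = asℕ-injective (λ i → ≤-antisym (v≤w i) (w≤v i))

module _ {n : ℕ} where

  Lax : ℕ → ℕ → Set
  Lax k = Seq.M (IterLax k (ChainSeq n))

  Lax-≤ : ∀ k {m} → Lax k m → Lax k m → Set
  Lax-≤ k = Seq._≼_ (IterLax k (ChainSeq n))

  base : ∀ k {m} → Lax k m → Vector ℕ n
  base zero    v           = asℕ v
  base (suc k) (lax _ _ a) = base k a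

  levels : ∀ k {m} → Lax k m → Vector ℕ k
  levels zero    _           ()
  levels (suc k) (lax j _ a) = levels k a ∷ʳ j

  coordinates : ∀ k {m} → Lax k m → Vector ℕ (n + k)
  coordinates k a = base k a ++ levels k a

  base-transport : ∀ k {j m} (p : j ≤′ m) (a : Lax k j) →
                   base k (transport (IterLax k (ChainSeq n)) p a) ≗ base k a
  base-transport k p a i =
    transport-invariant (IterLax k (ChainSeq n)) (λ a → base k a i) (base-step k) p a
    where
    base-step : ∀ k {m} (a : Lax k m) → base k (Seq.f (IterLax k (ChainSeq n)) m a) i ≡ base k a i
    base-step zero    v = asℕ-map-inject₁ v i
    base-step (suc k) a = refl

  levels-transport : ∀ k {j m} (p : j ≤′ m) (a : Lax k j) →
                     levels k (transport (IterLax k (ChainSeq n)) p a) ≗ levels k a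
  levels-transport zero    p a ()
  levels-transport (suc k) p a t =
    transport-invariant (IterLax (suc k) (ChainSeq n)) (λ a → levels (suc k) a t) (λ _ → refl) p a

  Lax-≤⇒pointwise : ∀ k {m} {a a′ : Lax k m} → Lax-≤ k a a′ →
        Pointwise _≤_ (base k a) (base k a′) × Pointwise _≤_ (levels k a) (levels k a′)
  Lax-≤⇒pointwise zero    v≤w = v≤w , λ ()
  Lax-≤⇒pointwise (suc k) {a = lax j p b} {lax j′ p′ b′} (q , tb≤b′) =
    let base≤ , levels≤ = Lax-≤⇒pointwise k tb≤b′ in
    (λ i → subst (_≤ base k b′ i) (base-transport k q b i) (base≤ i)) ,
    Pointwise-∷ʳ⁺ _≤_ (λ t → subst (_≤ levels k b′ t) (levels-transport k q b t) (levels≤ t)) (≤′⇒≤ q)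

  pointwise⇒Lax-≤ : ∀ k {m} {a a′ : Lax k m} →
        Pointwise _≤_ (base k a) (base k a′) → Pointwise _≤_ (levels k a) (levels k a′) → Lax-≤ k a a′
  pointwise⇒Lax-≤ zero    base≤ _ = base≤
  pointwise⇒Lax-≤ (suc k) {a = lax j p b} {lax j′ p′ b′} base≤ levels∷ʳj≤ =
    let levels≤ , j≤j′ = Pointwise-∷ʳ⁻ _≤_ (levels k b) (levels k b′) levels∷ʳj≤
        q = ≤⇒≤′ j≤j′
    in q , pointwise⇒Lax-≤ k (λ i → subst (_≤ base k b′ i) (sym (base-transport k q b i)) (base≤ i))
                 (λ t → subst (_≤ levels k b′ t) (sym (levels-transport k q b t)) (levels≤ t))

  base-bounded : ∀ k {m} (a : Lax k m) → All (_≤ m) (base k a)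
  base-bounded zero    v           = asℕ-bounded v
  base-bounded (suc k) (lax j p b) i = ≤-trans (base-bounded k b i) (≤′⇒≤ p)

  levels-bounded : ∀ k {m} (a : Lax k m) → All (_≤ m) (levels k a)
  levels-bounded zero    _           ()
  levels-bounded (suc k) (lax j p b) =
    All-∷ʳ⁺ {P = _≤ _} (λ t → ≤-trans (levels-bounded k b t) (≤′⇒≤ p)) (≤′⇒≤ p)

  base≤head-levels : ∀ k {m} (a : Lax (suc k) m) → All (_≤ head (levels (suc k) a)) (base (suc k) a)
  base≤head-levels zero    (lax j p b) = base-bounded zero b
  base≤head-levels (suc k) (lax j p b) = base≤head-levels k b

  levels-ascending : ∀ k {m} (a : Lax (suc k) m) → Ascending (levels (suc k) a)
  levels-ascending zero    _           ()
  levels-ascending (suc k) (lax j p b) =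
    ∷ʳ-ascending (levels-ascending k b) (levels-bounded (suc k) b (fromℕ k))

  coordinates-bounded : ∀ k {m} (a : Lax k m) → All (_≤ m) (coordinates k a)
  coordinates-bounded k a = All.++⁺ (_≤ _) (base-bounded k a) (levels-bounded k a)

  embed : ∀ k {m} → Lax k m → Vec (Fin (suc m)) (n + k)
  embed k a = fromBounded (coordinates k a) (coordinates-bounded k a)

  asℕ-embed : ∀ k {m} (a : Lax k m) → asℕ (embed k a) ≗ coordinates k a
  asℕ-embed k a = asℕ-fromBounded (coordinates k a) (coordinates-bounded k a)

  embed-subLatCond : ∀ k {m} (a : Lax k m) → SubLatCond n k m (embed k a)
  embed-subLatCond zero    a = tt
  embed-subLatCond (suc k) a =
    List.tabulate (λ {i} _ → subst₂ _≤_ (sym (embed-↑ˡ i)) (sym (embed-↑ʳ zero)) (base≤head-levels k a i)) ,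
    List.tabulate (λ {t} _ → subst₂ _≤_ (sym (embed-↑ʳ (inject₁ t))) (sym (embed-↑ʳ (suc t))) (levels-ascending k a t))
    where
    embed-↑ˡ : ∀ i → asℕ (embed (suc k) a) (i ↑ˡ suc k) ≡ base (suc k) a i
    embed-↑ˡ i = trans (asℕ-embed (suc k) a _) (lookup-++ˡ (base (suc k) a) (levels (suc k) a) i)
    embed-↑ʳ : ∀ t → asℕ (embed (suc k) a) (n ↑ʳ t) ≡ levels (suc k) a t
    embed-↑ʳ t = trans (asℕ-embed (suc k) a _) (lookup-++ʳ (base (suc k) a) (levels (suc k) a) t)

  toSubLat : ∀ k {m} → Lax k m → SubLat n k m
  toSubLat k a = embed k a , embed-subLatCond k a

  -- The sublattice condition unfolded along the nesting of lax pairs: the last level is the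
  -- outermost index, and the remaining levels must lie below it.
  Staircase : ∀ k → ℕ → Vector ℕ n → Vector ℕ k → Set
  Staircase zero    m B L = All (_≤ m) B
  Staircase (suc k) m B L = last L ≤ m × Staircase k (last L) B (init L)

  staircase : ∀ k {m B} {L : Vector ℕ (suc k)} →
              All (_≤ head L) B → Ascending L → last L ≤ m → Staircase (suc k) m B L
  staircase zero    below ascending top = top , below
  staircase (suc k) {L = L} below ascending top =
    top , staircase k {L = init L} below (ascending ∘ inject₁) (ascending (fromℕ k))

  fromStaircase : ∀ k {m} B L → Staircase k m B L → Lax k m
  fromStaircase zero    B L bounded       = fromBounded B bounded
  fromStaircase (suc k) B L (top , stairs) =
    lax (last L) (≤⇒≤′ top) (fromStaircase k B (init L) stairs)

  base-fromStaircase : ∀ k {m} B L (s : Staircase k m B L) → base k (fromStaircase k B L s) ≗ B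
  base-fromStaircase zero    B L bounded  = asℕ-fromBounded B bounded
  base-fromStaircase (suc k) B L (_ , s) = base-fromStaircase k B (init L) s

  levels-fromStaircase : ∀ k {m} B L (s : Staircase k m B L) → levels k (fromStaircase k B L s) ≗ L
  levels-fromStaircase zero    B L _       ()
  levels-fromStaircase (suc k) B L (_ , s) t =
    trans (∷ʳ-cong (levels-fromStaircase k B (init L) s) (last L) t) (init-∷ʳ-last L t)

  subLatCond⇒staircase : ∀ k {m} (v : Vec (Fin (suc m)) (n + k)) →
                         SubLatCond n k m v → Staircase k m (asℕ v ∘ (_↑ˡ k)) (asℕ v ∘ (n ↑ʳ_))
  subLatCond⇒staircase zero    v _                   = asℕ-bounded v ∘ (_↑ˡ 0)
  subLatCond⇒staircase (suc k) v (below , ascending) =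
    staircase k {L = asℕ v ∘ (n ↑ʳ_)} (List.lookup below ∘ ∈-allFin) (List.lookup ascending ∘ ∈-allFin)
      (asℕ-bounded v _)

  fromSubLat : ∀ k {m} → SubLat n k m → Lax k m
  fromSubLat k (v , c) = fromStaircase k _ _ (subLatCond⇒staircase k v c)

  subLatCond-irrelevant : ∀ k {m v} (c c′ : SubLatCond n k m v) → c ≡ c′
  subLatCond-irrelevant zero    _       _         = refl
  subLatCond-irrelevant (suc k) (b , a) (b′ , a′) =
    cong₂ _,_ (List.irrelevant ≤-irrelevant b b′) (List.irrelevant ≤-irrelevant a a′)

  subLat-≡ : ∀ k {m} {s s′ : SubLat n k m} → proj₁ s ≡ proj₁ s′ → s ≡ s′
  subLat-≡ k {s = v , c} {.v , c′} refl = cong (v ,_) (subLatCond-irrelevant k c c′)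

  toSubLat∘fromSubLat : ∀ k {m} (s : SubLat n k m) → toSubLat k (fromSubLat k s) ≡ s
  toSubLat∘fromSubLat k (v , c) = subLat-≡ k (asℕ-injective λ i → begin
    asℕ (embed k a) i                       ≡⟨ asℕ-embed k a i ⟩
    (base k a ++ levels k a) i              ≡⟨ ++-cong _ _ (base-fromStaircase k _ _ stairs)
                                                           (levels-fromStaircase k _ _ stairs) i ⟩
    (asℕ v ∘ (_↑ˡ k) ++ asℕ v ∘ (n ↑ʳ_)) i  ≡⟨ ++-split {k = k} {m = n} (asℕ v) i ⟩
    asℕ v i                                 ∎)
    where
    open ≡-Reasoning
    stairs = subLatCond⇒staircase k v c
    a = fromSubLat k (v , c)

  toSubLat-mono : ∀ k {m} {a a′ : Lax k m} → Lax-≤ k a a′ → toSubLat k a ≤S toSubLat k a′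
  toSubLat-mono k {a = a} {a′} a⊑a′ i =
    let base≤ , levels≤ = Lax-≤⇒pointwise k a⊑a′ in
    subst₂ _≤_ (sym (asℕ-embed k a i)) (sym (asℕ-embed k a′ i)) (Pointwise.++⁺ _≤_ base≤ levels≤ i)

  toSubLat-reflects : ∀ k {m} {a a′ : Lax k m} → toSubLat k a ≤S toSubLat k a′ → Lax-≤ k a a′
  toSubLat-reflects k {a = a} {a′} embed≤ =
    let base≤ , levels≤ = Pointwise.++⁻ _≤_ (base k a) (base k a′) coordinates≤ in pointwise⇒Lax-≤ k base≤ levels≤
    where
    coordinates≤ : Pointwise _≤_ (coordinates k a) (coordinates k a′)
    coordinates≤ i = subst₂ _≤_ (asℕ-embed k a i) (asℕ-embed k a′ i) (embed≤ i)

  iterLax-orderIso : ∀ k m → OrderIso (Lax k m) (Lax-≤ k) (SubLat n k m) _≤S_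
  iterLax-orderIso k m =
    orderIso-fromRightInverse (toSubLat k) (fromSubLat k) (toSubLat∘fromSubLat k)
      (toSubLat-mono k) (toSubLat-reflects k)
      (iterLax-antisym (ChainSeq n) (chainSeq-antisym n) k) (λ _ → ≤-refl)

theorem5p1 : (n k m : ℕ) →
    OrderIso (Seq.M (IterLax k (ChainSeq n)) m) (Seq._≼_ (IterLax k (ChainSeq n)))
    (SubLat n k m) _≤S_
theorem5p1 n k m = iterLax-orderIso k m
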